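{- Under the standing assumptions below, for any point $p\in P$ and any $x,y\in S_p$, if $x^+_p=y^+_p$ and $x^-_p=y^-_p$, then $x=y$.
   Context: Standing assumptions: $L$ is a distributive Fomin lattice with minimum element $\hat{0}$: a modular, locally finite lattice with finitely many upper and lower covers at each element, value set $V$, differential degree $r$, and weighting $w$ on coverings satisfying $\sum_{y\lessdot x}w(y\lessdot x)+r=\sum_{x\lessdot z}w(x\lessdot z)$ for all $x$, with $w$ projective-constant. Then $L$ is the lattice of finite order ideals of the poset $P$ of its join-irreducibles (points), and there is $w:P\to V$ with $w(x\lessdot y)=w(y\setminus x)$. $P$ is unique-cover-modular: whenever two distinct elements of $P$ both cover a common element or are both covered by a common element, there is a unique element covered by both and a unique element covering both. The weighting is positive on points: $V=\mathbb{Z}$ and $w(p)>0$ for all $p\in P$. Notation: for $p\in P$, $C_p^-$ is the set of elements covered by $p$, $C_p^+$ the set of elements covering $p$, and $S_p=\{x\in P: x\neq p,\ \exists a\in C_p^-, b\in C_p^+,\ a<x<b\}$. For $a\in S_p$, $a^+_p$ denotes the unique element of $C_p^+$ that is $>a$, and $a^-_p$ the unique element of $C_p^-$ that is $<a$ (these exist and are unique under the assumptions). -}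

module Defs where

open import Level using (0ℓ)
open import Data.Product using (Σ; ∃; ∃!; _×_; _,_)
open import Data.Sum using (_⊎_)
open import Data.Empty using (⊥)
open import Data.Integer using (ℤ; _+_; _<_; 0ℤ)
open import Data.List using (List; map; foldr)
open import Data.List.Membership.Propositional using (_∈_; _∉_)
open import Data.List.Relation.Unary.Unique.Propositional using (Unique)
open import Relation.Binary.PropositionalEquality using (_≡_; _≢_)
open import Relation.Binary.Structures using (IsPartialOrder)
open import Relation.Nullary using (¬_)

sumℤ : List ℤ → ℤ
sumℤ = foldr _+_ 0ℤ

record Enumerates {A : Set} (S : A → Set) (l : List A) : Set where
  field
    unique   : Unique l
    complete : ∀ a → S a → a ∈ l
    sound    : ∀ a → a ∈ l → S a

-- The poset P of points (join-irreducibles) of a distributive Fomin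
-- lattice L with minimum, together with the weighting w : P → ℤ and
-- differential degree r.  L is (isomorphic to) the lattice of finite
-- order ideals of P; a finite order ideal is represented by a list.
record DistFominPoset : Set₁ where
  field
    P     : Set
    _≤_   : P → P → Set
    isPO  : IsPartialOrder _≡_ _≤_

  infix 4 _<_ₚ _⋖_
  _<_ₚ : P → P → Set
  x < y ₚ = x ≤ y × x ≢ y

  _⋖_ : P → P → Set
  x ⋖ y = (x < y ₚ) × (∀ z → x < z ₚ → z < y ₚ → ⊥)

  IsIdeal : List P → Set
  IsIdeal I = ∀ x y → x ∈ I → y ≤ x → y ∈ I

  -- x ⋖ I' in L with I' = I ∖ {p}: p is maximal in I
  MaxOf : List P → P → Set
  MaxOf I p = p ∈ I × (∀ q → q ∈ I → ¬ (p < q ₚ))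

  -- I ⋖ I ∪ {p} in L: p is minimal in the complement of I
  MinOutside : List P → P → Set
  MinOutside I p = p ∉ I × (∀ q → q < p ₚ → q ∈ I)

  field
    w      : P → ℤ
    r      : ℤ
    w-pos  : ∀ p → 0ℤ < w p
    down-finite : ∀ p → Σ (List P) (Enumerates (λ q → q ≤ p))
    -- every element of L has finitely many lower and upper covers, and the
    -- Fomin (differential) condition
    --   Σ_{y ⋖ I} w(y ⋖ I) + r = Σ_{I ⋖ z} w(I ⋖ z)
    -- holds, where w(I ∖ {p} ⋖ I) = w(p) and w(I ⋖ I ∪ {p}) = w(p).
    fomin  : ∀ (I : List P) → IsIdeal I →
             Σ (List P) λ dn → Σ (List P) λ up →
               Enumerates (MaxOf I) dn × Enumerates (MinOutside I) up ×
               (sumℤ (map w dn) + r ≡ sumℤ (map w up))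
    -- P is unique-cover-modular (a consequence of the assumptions,
    -- recorded in the standing assumptions)
    ucm    : ∀ x y → x ≢ y →
             ((Σ P λ z → z ⋖ x × z ⋖ y) ⊎ (Σ P λ z → x ⋖ z × y ⋖ z)) →
             ∃! _≡_ (λ u → u ⋖ x × u ⋖ y) × ∃! _≡_ (λ v → x ⋖ v × y ⋖ v)

  C⁻ : P → P → Set
  C⁻ p a = a ⋖ p

  C⁺ : P → P → Set
  C⁺ p b = p ⋖ b

  S : P → P → Set
  S p x = x ≢ p × Σ P λ a → Σ P λ b → C⁻ p a × C⁺ p b × a < x ₚ × x < b ₚ

-- A covering diamond u ⋖ s, t ⋖ v contains no third element z: for the ideals I, I ∪ {s}, I ∪ {t},
-- I ∪ {s, t} with I = ↓v ∖ {s, t, v}, summing the Fomin identity with alternating signs shows that the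
-- weight of the maximal elements of I covered by both s and t equals the weight of the minimal elements
-- outside I ∪ {s, t} covering both.  The first set is empty, since by unique-cover-modularity its only
-- candidate is u, which lies below z ∈ I; the second contains v, whose weight is positive.
-- Well-founded induction on b then shows that whenever a ⋖ p ⋖ b, every other element of the interval
-- (a, b) covers a and is covered by b.  For x, y as in the theorem this gives a ⋖ x ⋖ b, so y lies in
-- the open interval of the diamond a ⋖ p, x ⋖ b.

module Submission where

open import Defs
open import Algebra.Bundles using (AbelianGroup)
open import Data.Bool.Base using (true; false; if_then_else_)
open import Data.Empty using (⊥; ⊥-elim)
open import Data.Integer as ℤ using (ℤ; _+_; 0ℤ)
open import Data.Integer.Properties
  using ( +-identityˡ; +-identityʳ; +-comm; <⇒≤; <-irrefl; +-mono-≤; +-mono-<-≤; +-mono-≤-<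
        ; +-commutativeSemigroup; +-0-abelianGroup )
open import Data.Integer.Tactic.RingSolver using (solve-∀)
open import Data.List.Base using (List; []; _∷_; map; length)
open import Data.List.Extrema.Nat using (argmax; argmax-all; f[xs]≤f[argmax])
open import Data.List.Membership.Propositional using (_∈_; _∉_; mapWith∈)
open import Data.List.Membership.Propositional.Properties using (mapWith∈-cong)
open import Data.List.Properties using (length-removeAt′)
open import Data.List.Relation.Binary.Subset.Propositional using (_⊆_)
import Data.List.Relation.Unary.All as All
open import Data.List.Relation.Unary.AllPairs using (_∷_)
open import Data.List.Relation.Unary.Any using (here; there; index; fromSum; toSum; _─_)
open import Data.List.Relation.Unary.Unique.Propositional using (Unique)
open import Data.Nat.Base as ℕ using (ℕ; suc; s≤s; z≤n)
open import Data.Nat.Induction using (<-wellFounded)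
open import Data.Nat.Properties using (<⇒≱)
open import Data.Product.Base as Prod using (Σ; _×_; _,_; proj₁; proj₂)
open import Data.Sum.Base using (_⊎_; inj₁; inj₂; [_,_]′)
open import Function.Base using (_∘_; case_of_)
import Induction.WellFounded as WF
open import Relation.Binary.Construct.On as On using ()
import Relation.Binary.Construct.NonStrictToStrict as NonStrictToStrict
open import Relation.Binary.PropositionalEquality
open import Relation.Binary.Structures using (IsPartialOrder)
open import Relation.Nullary using (¬_; Dec; yes; no; does)
open import Relation.Nullary.Decidable using (map′; ¬?; _×-dec_; _⊎-dec_; dec-true; dec-false)
open import Algebra.Properties.CommutativeSemigroup +-commutativeSemigroup using (interchange)
open import Algebra.Properties.Group (AbelianGroup.group +-0-abelianGroup) using (∙-cancelˡ)

private variable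
  X Y X₀ X₁ X₂ X₃ : Set

infixl 7 _when_
_when_ : ℤ → Dec X → ℤ
a when d = if does d then a else 0ℤ

when-yes : (d : Dec X) → X → ∀ a → a when d ≡ a
when-yes d x a rewrite dec-true d x = refl

when-no : (d : Dec X) → ¬ X → ∀ a → a when d ≡ 0ℤ
when-no d ¬x a rewrite dec-false d ¬x = refl

when-⊎ : (d : Dec X) (e : Dec Y) → ¬ (X × Y) → ∀ a → a when (d ⊎-dec e) ≡ a when d + a when e
when-⊎ (yes x) (yes y) ¬xy a = ⊥-elim (¬xy (x , y))
when-⊎ (yes _) (no _)  _   a = sym (+-identityʳ a)
when-⊎ (no _)  (yes _) _   a = sym (+-identityˡ a)
when-⊎ (no _)  (no _)  _   a = refl

0≤when : (d : Dec X) → ∀ {a} → 0ℤ ℤ.≤ a → 0ℤ ℤ.≤ a when d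
0≤when (yes _) 0≤a = 0≤a
0≤when (no _)  _   = ℤ.+≤+ z≤n

InclusionExclusion : ℤ → Dec X₀ → Dec X₁ → Dec X₂ → Dec X₃ → Set
InclusionExclusion a d₀ d₁ d₂ d₃ =
  a when d₀ + a when d₃ ≡ (a when d₁ + a when d₂) + a when (¬? d₁ ×-dec ¬? d₂)

inclusionExclusion-only₁₃ : ∀ a (d₀ : Dec X₀) (d₁ : Dec X₁) (d₂ : Dec X₂) (d₃ : Dec X₃) →
                           ¬ X₀ → X₁ → ¬ X₂ → X₃ → InclusionExclusion a d₀ d₁ d₂ d₃
inclusionExclusion-only₁₃ a (no _) (yes _) (no _) (yes _) _ _ _ _ =
  trans (+-identityˡ a) (sym (trans (+-identityʳ (a + 0ℤ)) (+-identityʳ a)))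
inclusionExclusion-only₁₃ a (yes x₀) _ _ _ ¬x₀ _ _ _ = ⊥-elim (¬x₀ x₀)
inclusionExclusion-only₁₃ a _ (no ¬x₁) _ _ _ x₁ _ _ = ⊥-elim (¬x₁ x₁)
inclusionExclusion-only₁₃ a _ _ (yes x₂) _ _ _ ¬x₂ _ = ⊥-elim (¬x₂ x₂)
inclusionExclusion-only₁₃ a _ _ _ (no ¬x₃) _ _ _ x₃ = ⊥-elim (¬x₃ x₃)

inclusionExclusion-only₂₃ : ∀ a (d₀ : Dec X₀) (d₁ : Dec X₁) (d₂ : Dec X₂) (d₃ : Dec X₃) →
                            ¬ X₀ → ¬ X₁ → X₂ → X₃ → InclusionExclusion a d₀ d₁ d₂ d₃
inclusionExclusion-only₂₃ a (no _) (no _) (yes _) (yes _) _ _ _ _ = sym (+-identityʳ (0ℤ + a))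
inclusionExclusion-only₂₃ a (yes x₀) _ _ _ ¬x₀ _ _ _ = ⊥-elim (¬x₀ x₀)
inclusionExclusion-only₂₃ a _ (yes x₁) _ _ _ ¬x₁ _ _ = ⊥-elim (¬x₁ x₁)
inclusionExclusion-only₂₃ a _ _ (no ¬x₂) _ _ _ x₂ _ = ⊥-elim (¬x₂ x₂)
inclusionExclusion-only₂₃ a _ _ _ (no ¬x₃) _ _ _ x₃ = ⊥-elim (¬x₃ x₃)

inclusionExclusion-in₀ : ∀ a (d₀ : Dec X₀) (d₁ : Dec X₁) (d₂ : Dec X₂) (d₃ : Dec X₃) →
                          X₀ → (X₃ → X₁ × X₂) → (X₁ → X₂ → X₃) → InclusionExclusion a d₀ d₁ d₂ d₃
inclusionExclusion-in₀ a (no ¬x₀) _ _ _ x₀ _ _ = ⊥-elim (¬x₀ x₀)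
inclusionExclusion-in₀ a (yes _) (yes x₁) (yes x₂) (no ¬x₃) _ _ ⇐ = ⊥-elim (¬x₃ (⇐ x₁ x₂))
inclusionExclusion-in₀ a (yes _) _ (no ¬x₂) (yes x₃) _ ⇒ _ = ⊥-elim (¬x₂ (proj₂ (⇒ x₃)))
inclusionExclusion-in₀ a (yes _) (no ¬x₁) _ (yes x₃) _ ⇒ _ = ⊥-elim (¬x₁ (proj₁ (⇒ x₃)))
inclusionExclusion-in₀ a (yes _) (yes _) (yes _) (yes _) _ _ _ = sym (+-identityʳ (a + a))
inclusionExclusion-in₀ a (yes _) (yes _) (no _)  (no _)  _ _ _ = sym (+-identityʳ (a + 0ℤ))
inclusionExclusion-in₀ a (yes _) (no _)  (yes _) (no _)  _ _ _ =
  trans (+-comm a 0ℤ) (sym (+-identityʳ (0ℤ + a)))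
inclusionExclusion-in₀ a (yes _) (no _)  (no _)  (no _)  _ _ _ = +-comm a 0ℤ

module _ {A : Set} where

  ∈-≟ : ∀ {W : List A} {x y} → Unique W → x ∈ W → y ∈ W → Dec (x ≡ y)
  ∈-≟ (_ ∷ _)    (here refl) (here refl) = yes refl
  ∈-≟ (x≢W ∷ _)  (here refl) (there y∈W) = no (All.lookup x≢W y∈W)
  ∈-≟ (y≢W ∷ _)  (there x∈W) (here refl) = no (All.lookup y≢W x∈W ∘ sym)
  ∈-≟ (_ ∷ W!)   (there x∈W) (there y∈W) = ∈-≟ W! x∈W y∈W

  ∈?-⊆ : ∀ {W : List A} {x} → Unique W → (l : List A) → l ⊆ W → x ∈ W → Dec (x ∈ l)
  ∈?-⊆ W! []      _   _   = no λ ()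
  ∈?-⊆ W! (y ∷ l) l⊆W x∈W =
    map′ fromSum toSum (∈-≟ W! x∈W (l⊆W (here refl)) ⊎-dec ∈?-⊆ W! l (l⊆W ∘ there) x∈W)

  Σ∈ : (xs : List A) → (∀ {x} → x ∈ xs → ℤ) → ℤ
  Σ∈ xs g = sumℤ (mapWith∈ xs g)

  Σ∈-cong : ∀ xs {g h : ∀ {x} → x ∈ xs → ℤ} → (∀ {x} (p : x ∈ xs) → g p ≡ h p) → Σ∈ xs g ≡ Σ∈ xs h
  Σ∈-cong xs g≗h = cong sumℤ (mapWith∈-cong xs _ _ g≗h)

  Σ∈-+ : ∀ xs (g h : ∀ {x} → x ∈ xs → ℤ) → Σ∈ xs (λ p → g p + h p) ≡ Σ∈ xs g + Σ∈ xs h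
  Σ∈-+ []       g h = refl
  Σ∈-+ (x ∷ xs) g h = begin
    (g (here refl) + h (here refl)) + Σ∈ xs (λ p → g (there p) + h (there p))
      ≡⟨ cong (g (here refl) + h (here refl) +_) (Σ∈-+ xs (g ∘ there) (h ∘ there)) ⟩
    (g (here refl) + h (here refl)) + (Σ∈ xs (g ∘ there) + Σ∈ xs (h ∘ there))
      ≡⟨ interchange (g (here refl)) (h (here refl)) (Σ∈ xs (g ∘ there)) (Σ∈ xs (h ∘ there)) ⟩
    (g (here refl) + Σ∈ xs (g ∘ there)) + (h (here refl) + Σ∈ xs (h ∘ there)) ∎
    where open ≡-Reasoning

  Σ∈-when-0 : ∀ {Q : A → Set} xs (d : ∀ {x} → x ∈ xs → Dec (Q x)) (f : A → ℤ) →
              (∀ {x} → x ∈ xs → ¬ Q x) → Σ∈ xs (λ {x} p → f x when d p) ≡ 0ℤ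
  Σ∈-when-0 []       d f ¬Q = refl
  Σ∈-when-0 (x ∷ xs) d f ¬Q =
    cong₂ _+_ (when-no (d (here refl)) (¬Q (here refl)) (f x)) (Σ∈-when-0 xs (d ∘ there) f (¬Q ∘ there))

  Σ∈-when-nonneg : ∀ {Q : A → Set} xs (d : ∀ {x} → x ∈ xs → Dec (Q x)) {f : A → ℤ} →
                   (∀ x → 0ℤ ℤ.≤ f x) → 0ℤ ℤ.≤ Σ∈ xs (λ {x} p → f x when d p)
  Σ∈-when-nonneg []       d 0≤f = ℤ.+≤+ z≤n
  Σ∈-when-nonneg (x ∷ xs) d 0≤f = +-mono-≤ (0≤when (d (here refl)) (0≤f x)) (Σ∈-when-nonneg xs (d ∘ there) 0≤f)

  Σ∈-when-pos : ∀ {Q : A → Set} xs (d : ∀ {x} → x ∈ xs → Dec (Q x)) {f : A → ℤ} →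
                (∀ x → 0ℤ ℤ.< f x) → ∀ {v} → v ∈ xs → Q v → 0ℤ ℤ.< Σ∈ xs (λ {x} p → f x when d p)
  Σ∈-when-pos (x ∷ xs) d {f} 0<f (here refl) Qx =
    +-mono-<-≤ (subst (0ℤ ℤ.<_) (sym (when-yes (d (here refl)) Qx (f x))) (0<f x))
               (Σ∈-when-nonneg xs (d ∘ there) (<⇒≤ ∘ 0<f))
  Σ∈-when-pos (x ∷ xs) d {f} 0<f (there v∈xs) Qv =
    +-mono-≤-< (0≤when (d (here refl)) (<⇒≤ (0<f x))) (Σ∈-when-pos xs (d ∘ there) 0<f v∈xs Qv)

  Σ∈-when-≟ : ∀ {W : List A} {y} (W! : Unique W) (y∈W : y ∈ W) (f : A → ℤ) →
              Σ∈ W (λ {x} p → f x when ∈-≟ W! p y∈W) ≡ f y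
  Σ∈-when-≟ {y ∷ W} (y≢W ∷ W!) (here refl) f =
    trans (cong (f y +_) (Σ∈-when-0 W (λ p → ∈-≟ (y≢W ∷ W!) (there p) (here refl)) f
                                       λ x∈W x≡y → All.lookup y≢W x∈W (sym x≡y)))
          (+-identityʳ (f y))
  Σ∈-when-≟ (_ ∷ W!) (there y∈W) f = trans (+-identityˡ _) (Σ∈-when-≟ W! y∈W f)

  sum-map-⊆ : ∀ {W : List A} (W! : Unique W) {l} → Unique l → (l⊆W : l ⊆ W) (f : A → ℤ) →
              sumℤ (map f l) ≡ Σ∈ W (λ {x} p → f x when ∈?-⊆ W! l l⊆W p)
  sum-map-⊆ {W} W! {[]}    _          l⊆W f = sym (Σ∈-when-0 W (∈?-⊆ W! [] l⊆W) f λ _ ())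
  sum-map-⊆ {W} W! {y ∷ l} (y∉l ∷ l!) l⊆W f = begin
    f y + sumℤ (map f l)
      ≡⟨ cong₂ _+_ (sym (Σ∈-when-≟ W! y∈W f)) (sum-map-⊆ W! l! (l⊆W ∘ there) f) ⟩
    Σ∈ W (λ {x} p → f x when ∈-≟ W! p y∈W) + Σ∈ W (λ {x} p → f x when ∈?-⊆ W! l (l⊆W ∘ there) p)
      ≡⟨ Σ∈-+ W (λ {x} p → f x when ∈-≟ W! p y∈W) (λ {x} p → f x when ∈?-⊆ W! l (l⊆W ∘ there) p) ⟨
    Σ∈ W (λ {x} p → f x when ∈-≟ W! p y∈W + f x when ∈?-⊆ W! l (l⊆W ∘ there) p)
      ≡⟨ Σ∈-cong W (λ {x} p → when-⊎ (∈-≟ W! p y∈W) (∈?-⊆ W! l (l⊆W ∘ there) p)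
                                      (λ (x≡y , x∈l) → All.lookup y∉l x∈l (sym x≡y)) (f x)) ⟨
    Σ∈ W (λ {x} p → f x when ∈?-⊆ W! (y ∷ l) l⊆W p) ∎
    where
      open ≡-Reasoning
      y∈W = l⊆W (here refl)

  -- Modelled on the lower covers of the ideals I, I ∪ {s}, I ∪ {t}, I ∪ {s, t}, and on their upper
  -- covers taken in reverse order.
  record IsDiamond (s t : A) (L₀ L₁ L₂ L₃ : List A) : Set where
    field
      unique    : Unique (s ∷ t ∷ L₀)
      unique₁   : Unique L₁
      unique₂   : Unique L₂
      unique₃   : Unique L₃
      L₁⊆       : L₁ ⊆ s ∷ t ∷ L₀
      L₂⊆       : L₂ ⊆ s ∷ t ∷ L₀
      L₃⊆       : L₃ ⊆ s ∷ t ∷ L₀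
      s∈L₁      : s ∈ L₁
      s∉L₂      : s ∉ L₂
      s∈L₃      : s ∈ L₃
      t∉L₁      : t ∉ L₁
      t∈L₂      : t ∈ L₂
      t∈L₃      : t ∈ L₃
      L₃⇒L₁×L₂  : ∀ {x} → x ∈ L₀ → x ∈ L₃ → x ∈ L₁ × x ∈ L₂
      L₁×L₂⇒L₃  : ∀ {x} → x ∈ L₀ → x ∈ L₁ → x ∈ L₂ → x ∈ L₃

    outside : ∀ {x} → x ∈ s ∷ t ∷ L₀ → Dec (x ∉ L₁ × x ∉ L₂)
    outside p = ¬? (∈?-⊆ unique L₁ L₁⊆ p) ×-dec ¬? (∈?-⊆ unique L₂ L₂⊆ p)

    defect : (A → ℤ) → ℤ
    defect f = Σ∈ (s ∷ t ∷ L₀) (λ {x} p → f x when outside p)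

  Σ-diamond : ∀ {s t L₀ L₁ L₂ L₃} (D : IsDiamond s t L₀ L₁ L₂ L₃) (f : A → ℤ) →
              sumℤ (map f L₀) + sumℤ (map f L₃) ≡ (sumℤ (map f L₁) + sumℤ (map f L₂)) + IsDiamond.defect D f
  Σ-diamond {s} {t} {L₀} {L₁} {L₂} {L₃} D f = begin
    sumℤ (map f L₀) + sumℤ (map f L₃)
      ≡⟨ cong₂ _+_ (sum-map-⊆ unique L₀! (there ∘ there) f) (sum-map-⊆ unique unique₃ L₃⊆ f) ⟩
    Σ∈ W g₀ + Σ∈ W g₃
      ≡⟨ Σ∈-+ W g₀ g₃ ⟨
    Σ∈ W (λ p → g₀ p + g₃ p)
      ≡⟨ Σ∈-cong W pointwise ⟩
    Σ∈ W (λ p → (g₁ p + g₂ p) + δ p)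
      ≡⟨ Σ∈-+ W (λ p → g₁ p + g₂ p) δ ⟩
    Σ∈ W (λ p → g₁ p + g₂ p) + defect f
      ≡⟨ cong (_+ defect f) (Σ∈-+ W g₁ g₂) ⟩
    (Σ∈ W g₁ + Σ∈ W g₂) + defect f
      ≡⟨ cong (_+ defect f) (cong₂ _+_ (sum-map-⊆ unique unique₁ L₁⊆ f) (sum-map-⊆ unique unique₂ L₂⊆ f)) ⟨
    (sumℤ (map f L₁) + sumℤ (map f L₂)) + defect f ∎
    where
      open ≡-Reasoning
      open IsDiamond D
      W = s ∷ t ∷ L₀
      L₀! : Unique L₀
      L₀! with _ ∷ _ ∷ L₀! ← unique = L₀!
      d₀ : ∀ {x} → x ∈ W → Dec (x ∈ L₀)
      d₀ = ∈?-⊆ unique L₀ (there ∘ there)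
      d₁ : ∀ {x} → x ∈ W → Dec (x ∈ L₁)
      d₁ = ∈?-⊆ unique L₁ L₁⊆
      d₂ : ∀ {x} → x ∈ W → Dec (x ∈ L₂)
      d₂ = ∈?-⊆ unique L₂ L₂⊆
      d₃ : ∀ {x} → x ∈ W → Dec (x ∈ L₃)
      d₃ = ∈?-⊆ unique L₃ L₃⊆
      g₀ g₁ g₂ g₃ δ : ∀ {x} → x ∈ W → ℤ
      g₀ {x} p = f x when d₀ p
      g₁ {x} p = f x when d₁ p
      g₂ {x} p = f x when d₂ p
      g₃ {x} p = f x when d₃ p
      δ  {x} p = f x when outside p
      pointwise : ∀ {x} (p : x ∈ W) → InclusionExclusion (f x) (d₀ p) (d₁ p) (d₂ p) (d₃ p)
      pointwise p@(here refl) =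
        inclusionExclusion-only₁₃ (f s) (d₀ p) (d₁ p) (d₂ p) (d₃ p) s∉L₀ s∈L₁ s∉L₂ s∈L₃
        where s∉L₀ : s ∉ L₀
              s∉L₀ s∈L₀ with s≢ ∷ _ ← unique = All.lookup s≢ (there s∈L₀) refl
      pointwise p@(there (here refl)) =
        inclusionExclusion-only₂₃ (f t) (d₀ p) (d₁ p) (d₂ p) (d₃ p) t∉L₀ t∉L₁ t∈L₂ t∈L₃
        where t∉L₀ : t ∉ L₀
              t∉L₀ t∈L₀ with _ ∷ t≢ ∷ _ ← unique = All.lookup t≢ t∈L₀ refl
      pointwise p@(there (there x∈L₀)) =
        inclusionExclusion-in₀ (f _) (d₀ p) (d₁ p) (d₂ p) (d₃ p) x∈L₀ (L₃⇒L₁×L₂ x∈L₀) (L₁×L₂⇒L₃ x∈L₀)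

  filterWith∈ : ∀ {Q : A → Set} (xs : List A) → (∀ {x} → x ∈ xs → Dec (Q x)) → List A
  filterWith∈ []       Q? = []
  filterWith∈ (x ∷ xs) Q? with does (Q? (here refl))
  ... | true  = x ∷ filterWith∈ xs (Q? ∘ there)
  ... | false = filterWith∈ xs (Q? ∘ there)

  ∈-filterWith∈⁺ : ∀ {Q : A → Set} {xs} (Q? : ∀ {x} → x ∈ xs → Dec (Q x)) {x} →
                   x ∈ xs → Q x → x ∈ filterWith∈ xs Q?
  ∈-filterWith∈⁺ Q? (here refl) Qx with Q? (here refl)
  ... | yes _  = here refl
  ... | no ¬Qx = ⊥-elim (¬Qx Qx)
  ∈-filterWith∈⁺ Q? (there x∈xs) Qx with does (Q? (here refl))
  ... | true  = there (∈-filterWith∈⁺ (Q? ∘ there) x∈xs Qx)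
  ... | false = ∈-filterWith∈⁺ (Q? ∘ there) x∈xs Qx

  ∈-filterWith∈⁻ : ∀ {Q : A → Set} {xs} (Q? : ∀ {x} → x ∈ xs → Dec (Q x)) {x} →
                   x ∈ filterWith∈ xs Q? → x ∈ xs × Q x
  ∈-filterWith∈⁻ {xs = y ∷ xs} Q? x∈ with Q? (here refl) | x∈
  ... | yes Qy | here refl = here refl , Qy
  ... | yes _  | there x∈′ = Prod.map₁ there (∈-filterWith∈⁻ (Q? ∘ there) x∈′)
  ... | no _   | x∈′       = Prod.map₁ there (∈-filterWith∈⁻ (Q? ∘ there) x∈′)

  ∈-─⁺ : ∀ {xs : List A} {x y} (x∈xs : x ∈ xs) → y ∈ xs → y ≢ x → y ∈ (xs ─ x∈xs)
  ∈-─⁺ (here refl)  (here refl)  y≢x = ⊥-elim (y≢x refl)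
  ∈-─⁺ (here refl)  (there y∈xs) _   = y∈xs
  ∈-─⁺ (there x∈xs) (here refl)  _   = here refl
  ∈-─⁺ (there x∈xs) (there y∈xs) y≢x = there (∈-─⁺ x∈xs y∈xs y≢x)

  length-<-⊆ : ∀ {xs ys : List A} {y} → Unique xs → xs ⊆ ys → y ∈ ys → y ∉ xs → length xs ℕ.< length ys
  length-<-⊆ {[]}     {_ ∷ _} _ _ _ _ = s≤s z≤n
  length-<-⊆ {x ∷ xs} {ys} (x∉xs ∷ xs!) xs⊆ys y∈ys y∉xs =
    subst (suc (length xs) ℕ.<_) (sym (length-removeAt′ ys (index x∈ys)))
      (s≤s (length-<-⊆ xs! (λ z∈xs → ∈-─⁺ x∈ys (xs⊆ys (there z∈xs)) (All.lookup x∉xs z∈xs ∘ sym))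
                           (∈-─⁺ x∈ys y∈ys (y∉xs ∘ here)) (y∉xs ∘ there)))
    where x∈ys = xs⊆ys (here refl)

module _ (F : DistFominPoset) where
  open DistFominPoset F
  open IsPartialOrder isPO using (antisym) renaming (refl to ≤-refl; trans to ≤-trans)
  open Enumerates
  private module Strict = NonStrictToStrict _≡_ _≤_

  <ₚ-trans : ∀ {x y z} → x < y ₚ → y < z ₚ → x < z ₚ
  <ₚ-trans = Strict.<-trans isPO

  <ₚ-≤-trans : ∀ {x y z} → x < y ₚ → y ≤ z → x < z ₚ
  <ₚ-≤-trans = Strict.<-≤-trans sym ≤-trans antisym (λ y≡z → subst (_ ≤_) y≡z)

  ≤-<ₚ-trans : ∀ {x y z} → x ≤ y → y < z ₚ → x < z ₚ
  ≤-<ₚ-trans = Strict.≤-<-trans ≤-trans antisym (λ x≡y → subst (_≤ _) x≡y)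

  ⋖⇒<ₚ : ∀ {x y} → x ⋖ y → x < y ₚ
  ⋖⇒<ₚ = proj₁

  ⋖-empty : ∀ {x y z} → x ⋖ y → x < z ₚ → z < y ₚ → ⊥
  ⋖-empty x⋖y = proj₂ x⋖y _

  ↓ : P → List P
  ↓ b = proj₁ (down-finite b)

  ↓-enum : ∀ b → Enumerates (_≤ b) (↓ b)
  ↓-enum b = proj₂ (down-finite b)

  ∈↓ : ∀ {x b} → x ≤ b → x ∈ ↓ b
  ∈↓ x≤b = complete (↓-enum _) _ x≤b

  ↓-mono : ∀ {x y} → x ≤ y → ↓ x ⊆ ↓ y
  ↓-mono x≤y q∈↓x = ∈↓ (≤-trans (sound (↓-enum _) _ q∈↓x) x≤y)

  ≟-below : ∀ b {x y} → x ≤ b → y ≤ b → Dec (x ≡ y)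
  ≟-below b x≤b y≤b = ∈-≟ (unique (↓-enum b)) (∈↓ x≤b) (∈↓ y≤b)

  ≤?-below : ∀ b {x y} → x ≤ b → y ≤ b → Dec (x ≤ y)
  ≤?-below b x≤b y≤b =
    map′ (sound (↓-enum _) _) (complete (↓-enum _) _) (∈?-⊆ (unique (↓-enum b)) _ (↓-mono y≤b) (∈↓ x≤b))

  <?-below : ∀ b {x y} → x ≤ b → y ≤ b → Dec (x < y ₚ)
  <?-below b x≤b y≤b = ≤?-below b x≤b y≤b ×-dec ¬? (≟-below b x≤b y≤b)

  size : P → ℕ
  size b = length (↓ b)

  size-mono : ∀ {x y} → x < y ₚ → size x ℕ.< size y
  size-mono (x≤y , x≢y) =
    length-<-⊆ (unique (↓-enum _)) (↓-mono x≤y) (∈↓ ≤-refl) (x≢y ∘ antisym x≤y ∘ sound (↓-enum _) _)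

  <ₚ-wellFounded : WF.WellFounded _<_ₚ
  <ₚ-wellFounded = WF.Subrelation.wellFounded size-mono (On.wellFounded size <-wellFounded)

  cover-above : ∀ {z b} → z < b ₚ → Σ P λ c → z ≤ c × c ⋖ b
  cover-above {z} {b} z<b = c , proj₁ c-between , proj₂ c-between , c-maximal
    where
      Between : P → Set
      Between q = z ≤ q × q < b ₚ
      between? : ∀ {q} → q ∈ ↓ b → Dec (Between q)
      between? q∈↓b = ≤?-below b (proj₁ z<b) q≤b ×-dec <?-below b q≤b ≤-refl
        where q≤b = sound (↓-enum b) _ q∈↓b
      candidates = filterWith∈ (↓ b) between?
      c = argmax size z candidates
      c-between : Between c
      c-between = argmax-all size (≤-refl , z<b) (All.tabulate (proj₂ ∘ ∈-filterWith∈⁻ between?))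
      c-maximal : ∀ q → c < q ₚ → q < b ₚ → ⊥
      c-maximal q c<q q<b = <⇒≱ (size-mono c<q)
        (All.lookup (f[xs]≤f[argmax] z candidates)
                    (∈-filterWith∈⁺ between? (∈↓ (proj₁ q<b)) (≤-trans (proj₁ c-between) (proj₁ c<q) , q<b)))

  MaxOf-⊆ : ∀ {I J x} → J ⊆ I → x ∈ J → MaxOf I x → MaxOf J x
  MaxOf-⊆ J⊆I x∈J (_ , x-max) = x∈J , λ q q∈J → x-max q (J⊆I q∈J)

  MaxOf-∪ : ∀ {I J K x} → (∀ {q} → q ∈ K → q ∈ I ⊎ q ∈ J) → x ∈ K → MaxOf I x → MaxOf J x → MaxOf K x
  MaxOf-∪ K⊆I∪J x∈K (_ , x-maxᴵ) (_ , x-maxᴶ) = x∈K , λ q q∈K → [ x-maxᴵ q , x-maxᴶ q ]′ (K⊆I∪J q∈K)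

  MaxOf-∷ : ∀ {I y} → IsIdeal I → y ∉ I → MaxOf (y ∷ I) y
  MaxOf-∷ I-ideal y∉I = here refl , λ
    { q (here refl) (_ , y≢y) → y≢y refl
    ; q (there q∈I) (y≤q , _) → y∉I (I-ideal q _ q∈I y≤q) }

  MinOutside-⊆ : ∀ {I J c} → I ⊆ J → c ∉ J → MinOutside I c → MinOutside J c
  MinOutside-⊆ I⊆J c∉J (_ , c-min) = c∉J , λ q q<c → I⊆J (c-min q q<c)

  MinOutside-∩ : ∀ {I J K c} → (∀ {q} → q ∈ I → q ∈ J → q ∈ K) → c ∉ K →
                 MinOutside I c → MinOutside J c → MinOutside K c
  MinOutside-∩ I∩J⊆K c∉K (_ , c-minᴵ) (_ , c-minᴶ) = c∉K , λ q q<c → I∩J⊆K (c-minᴵ q q<c) (c-minᴶ q q<c)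

  ∷-ideal : ∀ {I y} → IsIdeal I → MinOutside I y → IsIdeal (y ∷ I)
  ∷-ideal I-ideal (_ , y-min) x q (there x∈I) q≤x = there (I-ideal x q x∈I q≤x)
  ∷-ideal {y = y} I-ideal (_ , y-min) x q (here refl) q≤y with ≟-below y q≤y ≤-refl
  ... | yes refl = here refl
  ... | no q≢y   = there (y-min q (q≤y , q≢y))

  record Covers (I : List P) : Set where
    field
      lower        : List P
      upper        : List P
      lower-enum   : Enumerates (MaxOf I) lower
      upper-enum   : Enumerates (MinOutside I) upper
      fomin-balance : sumℤ (map w lower) + r ≡ sumℤ (map w upper)

    lower⇒MaxOf : ∀ {x} → x ∈ lower → MaxOf I x
    lower⇒MaxOf = sound lower-enum _

    MaxOf⇒lower : ∀ {x} → MaxOf I x → x ∈ lower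
    MaxOf⇒lower = complete lower-enum _

    upper⇒MinOutside : ∀ {x} → x ∈ upper → MinOutside I x
    upper⇒MinOutside = sound upper-enum _

    MinOutside⇒upper : ∀ {x} → MinOutside I x → x ∈ upper
    MinOutside⇒upper = complete upper-enum _

  covers : ∀ {I} → IsIdeal I → Covers I
  covers {I} I-ideal =
    let lower , upper , lower-enum , upper-enum , fomin-balance = fomin I I-ideal
    in record { lower = lower ; upper = upper ; lower-enum = lower-enum
              ; upper-enum = upper-enum ; fomin-balance = fomin-balance }

  module IdealDiamond {I₀ : List P} (I₀-ideal : IsIdeal I₀) {s t : P} (s≢t : s ≢ t)
                      (s-min : MinOutside I₀ s) (t-min : MinOutside I₀ t) where

    I₁ I₂ I₃ : List P
    I₁ = s ∷ I₀
    I₂ = t ∷ I₀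
    I₃ = s ∷ I₂

    s∉I₀ : s ∉ I₀
    s∉I₀ = proj₁ s-min

    t∉I₀ : t ∉ I₀
    t∉I₀ = proj₁ t-min

    s∉I₂ : s ∉ I₂
    s∉I₂ (here s≡t)  = s≢t s≡t
    s∉I₂ (there s∈I₀) = s∉I₀ s∈I₀

    t∉I₁ : t ∉ I₁
    t∉I₁ (here t≡s)  = s≢t (sym t≡s)
    t∉I₁ (there t∈I₀) = t∉I₀ t∈I₀

    I₁⊆I₃ : I₁ ⊆ I₃
    I₁⊆I₃ (here refl)  = here refl
    I₁⊆I₃ (there q∈I₀) = there (there q∈I₀)

    I₃⊆I₁∪I₂ : ∀ {q} → q ∈ I₃ → q ∈ I₁ ⊎ q ∈ I₂
    I₃⊆I₁∪I₂ (here refl)  = inj₁ (here refl)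
    I₃⊆I₁∪I₂ (there q∈I₂) = inj₂ q∈I₂

    I₁∩I₂⊆I₀ : ∀ {q} → q ∈ I₁ → q ∈ I₂ → q ∈ I₀
    I₁∩I₂⊆I₀ (here refl)  (here s≡t)   = ⊥-elim (s≢t s≡t)
    I₁∩I₂⊆I₀ (here refl)  (there q∈I₀) = q∈I₀
    I₁∩I₂⊆I₀ (there q∈I₀) _            = q∈I₀

    I₁-ideal : IsIdeal I₁
    I₁-ideal = ∷-ideal I₀-ideal s-min

    I₂-ideal : IsIdeal I₂
    I₂-ideal = ∷-ideal I₀-ideal t-min

    I₃-ideal : IsIdeal I₃
    I₃-ideal = ∷-ideal I₂-ideal (MinOutside-⊆ there s∉I₂ s-min)

    module C₀ = Covers (covers I₀-ideal)
    module C₁ = Covers (covers I₁-ideal)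
    module C₂ = Covers (covers I₂-ideal)
    module C₃ = Covers (covers I₃-ideal)

    lower-diamond : IsDiamond s t C₀.lower C₁.lower C₂.lower C₃.lower
    lower-diamond = record
      { unique   = (s≢t All.∷ All.tabulate (∉⇒≢ s∉I₀ ∘ lower₀⊆I₀))
                   ∷ All.tabulate (∉⇒≢ t∉I₀ ∘ lower₀⊆I₀)
                   ∷ unique C₀.lower-enum
      ; unique₁  = unique C₁.lower-enum
      ; unique₂  = unique C₂.lower-enum
      ; unique₃  = unique C₃.lower-enum
      ; L₁⊆      = λ x∈L₁ → L₁⊆ (proj₁ (C₁.lower⇒MaxOf x∈L₁)) (C₁.lower⇒MaxOf x∈L₁)
      ; L₂⊆      = λ x∈L₂ → L₂⊆ (proj₁ (C₂.lower⇒MaxOf x∈L₂)) (C₂.lower⇒MaxOf x∈L₂)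
      ; L₃⊆      = λ x∈L₃ → L₃⊆ (proj₁ (C₃.lower⇒MaxOf x∈L₃)) (C₃.lower⇒MaxOf x∈L₃)
      ; s∈L₁     = C₁.MaxOf⇒lower (MaxOf-∷ I₀-ideal s∉I₀)
      ; s∉L₂     = s∉I₂ ∘ proj₁ ∘ C₂.lower⇒MaxOf
      ; s∈L₃     = C₃.MaxOf⇒lower (MaxOf-∷ I₂-ideal s∉I₂)
      ; t∉L₁     = t∉I₁ ∘ proj₁ ∘ C₁.lower⇒MaxOf
      ; t∈L₂     = C₂.MaxOf⇒lower (MaxOf-∷ I₀-ideal t∉I₀)
      ; t∈L₃     = C₃.MaxOf⇒lower (MaxOf-⊆ I₃⊆t∷I₁ (there (here refl)) (MaxOf-∷ I₁-ideal t∉I₁))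
      ; L₃⇒L₁×L₂ = λ x∈L₀ x∈L₃ →
          C₁.MaxOf⇒lower (MaxOf-⊆ I₁⊆I₃ (there (lower₀⊆I₀ x∈L₀)) (C₃.lower⇒MaxOf x∈L₃)) ,
          C₂.MaxOf⇒lower (MaxOf-⊆ there (there (lower₀⊆I₀ x∈L₀)) (C₃.lower⇒MaxOf x∈L₃))
      ; L₁×L₂⇒L₃ = λ x∈L₀ x∈L₁ x∈L₂ →
          C₃.MaxOf⇒lower (MaxOf-∪ I₃⊆I₁∪I₂ (there (there (lower₀⊆I₀ x∈L₀)))
                                  (C₁.lower⇒MaxOf x∈L₁) (C₂.lower⇒MaxOf x∈L₂))
      }
      where
        ∉⇒≢ : ∀ {I y x} → y ∉ I → x ∈ I → y ≢ x
        ∉⇒≢ y∉I x∈I refl = y∉I x∈I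
        lower₀⊆I₀ : C₀.lower ⊆ I₀
        lower₀⊆I₀ = proj₁ ∘ C₀.lower⇒MaxOf
        toLower₀ : ∀ {I x} → I₀ ⊆ I → x ∈ I₀ → MaxOf I x → x ∈ s ∷ t ∷ C₀.lower
        toLower₀ I₀⊆I x∈I₀ x-max = there (there (C₀.MaxOf⇒lower (MaxOf-⊆ I₀⊆I x∈I₀ x-max)))
        L₁⊆ : ∀ {x} → x ∈ I₁ → MaxOf I₁ x → x ∈ s ∷ t ∷ C₀.lower
        L₁⊆ (here refl)  _     = here refl
        L₁⊆ (there x∈I₀) x-max = toLower₀ there x∈I₀ x-max
        L₂⊆ : ∀ {x} → x ∈ I₂ → MaxOf I₂ x → x ∈ s ∷ t ∷ C₀.lower
        L₂⊆ (here refl)  _     = there (here refl)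
        L₂⊆ (there x∈I₀) x-max = toLower₀ there x∈I₀ x-max
        L₃⊆ : ∀ {x} → x ∈ I₃ → MaxOf I₃ x → x ∈ s ∷ t ∷ C₀.lower
        L₃⊆ (here refl)          _     = here refl
        L₃⊆ (there (here refl))  _     = there (here refl)
        L₃⊆ (there (there x∈I₀)) x-max = toLower₀ (there ∘ there) x∈I₀ x-max
        I₃⊆t∷I₁ : I₃ ⊆ t ∷ I₁
        I₃⊆t∷I₁ (here refl)          = there (here refl)
        I₃⊆t∷I₁ (there (here refl))  = here refl
        I₃⊆t∷I₁ (there (there q∈I₀)) = there (there q∈I₀)

    upper-diamond : IsDiamond s t C₃.upper C₂.upper C₁.upper C₀.upper
    upper-diamond = record
      { unique   = (s≢t All.∷ All.tabulate (∉⇒≢ (here refl) ∘ upper₃∉I₃))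
                   ∷ All.tabulate (∉⇒≢ (there (here refl)) ∘ upper₃∉I₃)
                   ∷ unique C₃.upper-enum
      ; unique₁  = unique C₂.upper-enum
      ; unique₂  = unique C₁.upper-enum
      ; unique₃  = unique C₀.upper-enum
      ; L₁⊆      = L₁⊆
      ; L₂⊆      = L₂⊆
      ; L₃⊆      = L₃⊆
      ; s∈L₁     = s∈upper₂
      ; s∉L₂     = λ s∈L₂ → proj₁ (C₁.upper⇒MinOutside s∈L₂) (here refl)
      ; s∈L₃     = s∈upper₀
      ; t∉L₁     = λ t∈L₁ → proj₁ (C₂.upper⇒MinOutside t∈L₁) (here refl)
      ; t∈L₂     = t∈upper₁
      ; t∈L₃     = t∈upper₀
      ; L₃⇒L₁×L₂ = λ x∈L₀ x∈L₃ →
          C₂.MinOutside⇒upper (MinOutside-⊆ there (upper₃∉I₃ x∈L₀ ∘ there) (C₀.upper⇒MinOutside x∈L₃)) ,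
          C₁.MinOutside⇒upper (MinOutside-⊆ there (upper₃∉I₃ x∈L₀ ∘ I₁⊆I₃) (C₀.upper⇒MinOutside x∈L₃))
      ; L₁×L₂⇒L₃ = λ x∈L₀ x∈L₁ x∈L₂ →
          C₀.MinOutside⇒upper (MinOutside-∩ (λ q∈I₂ q∈I₁ → I₁∩I₂⊆I₀ q∈I₁ q∈I₂)
                                             (upper₃∉I₃ x∈L₀ ∘ there ∘ there)
                                             (C₂.upper⇒MinOutside x∈L₁) (C₁.upper⇒MinOutside x∈L₂))
      }
      where
        ∉⇒≢ : ∀ {I y x} → y ∈ I → x ∉ I → y ≢ x
        ∉⇒≢ y∈I x∉I refl = x∉I y∈I
        upper₃∉I₃ : ∀ {x} → x ∈ C₃.upper → x ∉ I₃
        upper₃∉I₃ = proj₁ ∘ C₃.upper⇒MinOutside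
        s∈upper₂ : s ∈ C₂.upper
        s∈upper₂ = C₂.MinOutside⇒upper (MinOutside-⊆ there s∉I₂ s-min)
        t∈upper₁ : t ∈ C₁.upper
        t∈upper₁ = C₁.MinOutside⇒upper (MinOutside-⊆ there t∉I₁ t-min)
        s∈upper₀ : s ∈ C₀.upper
        s∈upper₀ = C₀.MinOutside⇒upper s-min
        t∈upper₀ : t ∈ C₀.upper
        t∈upper₀ = C₀.MinOutside⇒upper t-min
        toUpper₃ : ∀ {I x} → I ⊆ I₃ → x ∉ I₃ → MinOutside I x → x ∈ s ∷ t ∷ C₃.upper
        toUpper₃ I⊆I₃ x∉I₃ x-min = there (there (C₃.MinOutside⇒upper (MinOutside-⊆ I⊆I₃ x∉I₃ x-min)))
        L₁⊆ : C₂.upper ⊆ s ∷ t ∷ C₃.upper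
        L₁⊆ x∈L₁ with ∈-≟ (unique C₂.upper-enum) x∈L₁ s∈upper₂
        ... | yes refl = here refl
        ... | no x≢s   = toUpper₃ there (λ { (here x≡s) → x≢s x≡s ; (there x∈I₂) → x∉I₂ x∈I₂ }) x-min
          where x-min = C₂.upper⇒MinOutside x∈L₁
                x∉I₂ = proj₁ x-min
        L₂⊆ : C₁.upper ⊆ s ∷ t ∷ C₃.upper
        L₂⊆ x∈L₂ with ∈-≟ (unique C₁.upper-enum) x∈L₂ t∈upper₁
        ... | yes refl = there (here refl)
        ... | no x≢t   = toUpper₃ I₁⊆I₃ (λ { (here x≡s) → x∉I₁ (here x≡s)
                                         ; (there (here x≡t)) → x≢t x≡t
                                         ; (there (there x∈I₀)) → x∉I₁ (there x∈I₀) }) x-min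
          where x-min = C₁.upper⇒MinOutside x∈L₂
                x∉I₁ = proj₁ x-min
        L₃⊆ : C₀.upper ⊆ s ∷ t ∷ C₃.upper
        L₃⊆ x∈L₃ with ∈-≟ (unique C₀.upper-enum) x∈L₃ s∈upper₀
                    | ∈-≟ (unique C₀.upper-enum) x∈L₃ t∈upper₀
        ... | yes refl | _        = here refl
        ... | no _     | yes refl = there (here refl)
        ... | no x≢s   | no x≢t   = toUpper₃ (there ∘ there) (λ { (here x≡s) → x≢s x≡s
                                                               ; (there (here x≡t)) → x≢t x≡t
                                                               ; (there (there x∈I₀)) → proj₁ x-min x∈I₀ }) x-min
          where x-min = C₀.upper⇒MinOutside x∈L₃

    defects-agree : IsDiamond.defect lower-diamond w ≡ IsDiamond.defect upper-diamond w
    defects-agree = ∙-cancelˡ (U₂ + U₁) δ ε (begin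
      (U₂ + U₁) + δ                   ≡⟨ cong₂ (λ a b → (a + b) + δ) C₂.fomin-balance C₁.fomin-balance ⟨
      ((D₂ + r) + (D₁ + r)) + δ       ≡⟨ shuffle D₁ D₂ δ r ⟩
      ((D₁ + D₂) + δ) + (r + r)       ≡⟨ cong (_+ (r + r)) (Σ-diamond lower-diamond w) ⟨
      (D₀ + D₃) + (r + r)             ≡⟨ interchange′ D₀ D₃ r ⟩
      (D₃ + r) + (D₀ + r)             ≡⟨ cong₂ _+_ C₃.fomin-balance C₀.fomin-balance ⟩
      U₃ + U₀                         ≡⟨ Σ-diamond upper-diamond w ⟩
      (U₂ + U₁) + ε                   ∎)
      where
        open ≡-Reasoning
        δ = IsDiamond.defect lower-diamond w
        ε = IsDiamond.defect upper-diamond w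
        D₀ = sumℤ (map w C₀.lower)
        D₁ = sumℤ (map w C₁.lower)
        D₂ = sumℤ (map w C₂.lower)
        D₃ = sumℤ (map w C₃.lower)
        U₀ = sumℤ (map w C₀.upper)
        U₁ = sumℤ (map w C₁.upper)
        U₂ = sumℤ (map w C₂.upper)
        U₃ = sumℤ (map w C₃.upper)
        shuffle : ∀ a b c r → ((b + r) + (a + r)) + c ≡ ((a + b) + c) + (r + r)
        shuffle = solve-∀
        interchange′ : ∀ a b r → (a + b) + (r + r) ≡ (b + r) + (a + r)
        interchange′ = solve-∀

  MaxOf-∷⁺ : ∀ {I x y} → MaxOf I x → ¬ (x < y ₚ) → MaxOf (y ∷ I) x
  MaxOf-∷⁺ (x∈I , x-max) x≮y = there x∈I , λ
    { q (here refl) x<y → x≮y x<y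
    ; q (there q∈I)     → x-max q q∈I }

  MaxOf-⋖ : ∀ {I x y} → MaxOf I x → MinOutside I y → x < y ₚ → x ⋖ y
  MaxOf-⋖ (_ , x-max) (_ , y-min) x<y = x<y , λ q x<q q<y → x-max q (y-min q q<y) x<q

  ⋖-common-lower-unique : ∀ {s t v x y} → s ⋖ v → t ⋖ v → s ≢ t →
                          x ⋖ s → x ⋖ t → y ⋖ s → y ⋖ t → x ≡ y
  ⋖-common-lower-unique s⋖v t⋖v s≢t x⋖s x⋖t y⋖s y⋖t
    with (m , _ , m-unique) , _ ← ucm _ _ s≢t (inj₂ (_ , s⋖v , t⋖v))
    = trans (sym (m-unique (x⋖s , x⋖t))) (m-unique (y⋖s , y⋖t))

  module ThirdElementOfDiamond {u s t v : P} (u⋖s : u ⋖ s) (u⋖t : u ⋖ t) (s⋖v : s ⋖ v) (t⋖v : t ⋖ v)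
                               (s≢t : s ≢ t) {z : P} (u<z : u < z ₚ) (z<v : z < v ₚ) (z≢s : z ≢ s) (z≢t : z ≢ t) where

    Keep : P → Set
    Keep q = q ≢ v × q ≢ s × q ≢ t

    keep? : ∀ {q} → q ∈ ↓ v → Dec (Keep q)
    keep? q∈↓v = ¬? (≟ q∈↓v (∈↓ ≤-refl)) ×-dec ¬? (≟ q∈↓v (∈↓ s≤v)) ×-dec ¬? (≟ q∈↓v (∈↓ t≤v))
      where
        ≟ : ∀ {x y} → x ∈ ↓ v → y ∈ ↓ v → Dec (x ≡ y)
        ≟ = ∈-≟ (unique (↓-enum v))
        s≤v = proj₁ (⋖⇒<ₚ s⋖v)
        t≤v = proj₁ (⋖⇒<ₚ t⋖v)

    I₀ : List P
    I₀ = filterWith∈ (↓ v) keep?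

    ∈I₀⁺ : ∀ {q} → q < v ₚ → q ≢ s → q ≢ t → q ∈ I₀
    ∈I₀⁺ (q≤v , q≢v) q≢s q≢t = ∈-filterWith∈⁺ keep? (∈↓ q≤v) (q≢v , q≢s , q≢t)

    ∈I₀⁻ : ∀ {q} → q ∈ I₀ → q < v ₚ × q ≢ s × q ≢ t
    ∈I₀⁻ q∈I₀ with q∈↓v , q≢v , q≢s , q≢t ← ∈-filterWith∈⁻ keep? q∈I₀ =
      (sound (↓-enum v) _ q∈↓v , q≢v) , q≢s , q≢t

    I₀-ideal : IsIdeal I₀
    I₀-ideal x q x∈I₀ q≤x with x<v , x≢s , x≢t ← ∈I₀⁻ x∈I₀ =
      ∈I₀⁺ (≤-<ₚ-trans q≤x x<v) (not-cover s⋖v x≢s) (not-cover t⋖v x≢t)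
      where
        not-cover : ∀ {y} → y ⋖ v → x ≢ y → q ≢ y
        not-cover y⋖v x≢y refl = ⋖-empty y⋖v (q≤x , x≢y ∘ sym) x<v

    s-min : MinOutside I₀ s
    s-min = (λ s∈I₀ → proj₁ (proj₂ (∈I₀⁻ s∈I₀)) refl) , λ q q<s →
      ∈I₀⁺ (<ₚ-trans q<s (⋖⇒<ₚ s⋖v)) (proj₂ q<s) (λ { refl → ⋖-empty t⋖v q<s (⋖⇒<ₚ s⋖v) })

    t-min : MinOutside I₀ t
    t-min = (λ t∈I₀ → proj₂ (proj₂ (∈I₀⁻ t∈I₀)) refl) , λ q q<t →
      ∈I₀⁺ (<ₚ-trans q<t (⋖⇒<ₚ t⋖v)) (λ { refl → ⋖-empty s⋖v q<t (⋖⇒<ₚ t⋖v) }) (proj₂ q<t)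

    open IdealDiamond I₀-ideal s≢t s-min t-min

    lower-defect≡0 : IsDiamond.defect lower-diamond w ≡ 0ℤ
    lower-defect≡0 = Σ∈-when-0 _ (IsDiamond.outside lower-diamond) w λ
      { (here refl)          (s∉L₁ , _) → s∉L₁ (IsDiamond.s∈L₁ lower-diamond)
      ; (there (here refl))  (_ , t∉L₂) → t∉L₂ (IsDiamond.t∈L₂ lower-diamond)
      ; (there (there x∈L₀)) (x∉L₁ , x∉L₂) →
          not-both (C₀.lower⇒MaxOf x∈L₀) (x∉L₁ ∘ C₁.MaxOf⇒lower) (x∉L₂ ∘ C₂.MaxOf⇒lower) }
      where
        not-both : ∀ {x} → MaxOf I₀ x → ¬ MaxOf I₁ x → ¬ MaxOf I₂ x → ⊥
        not-both x-max ¬max₁ ¬max₂ = ¬max₁ (MaxOf-∷⁺ x-max λ x<s → ¬max₂ (MaxOf-∷⁺ x-max λ x<t →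
          let x≡u = ⋖-common-lower-unique s⋖v t⋖v s≢t (MaxOf-⋖ x-max s-min x<s) (MaxOf-⋖ x-max t-min x<t) u⋖s u⋖t
          in proj₂ x-max z (∈I₀⁺ z<v z≢s z≢t) (subst (_< z ₚ) (sym x≡u) u<z)))

    upper-defect-positive : 0ℤ ℤ.< IsDiamond.defect upper-diamond w
    upper-defect-positive =
      Σ∈-when-pos _ (IsDiamond.outside upper-diamond) w-pos (there (there (C₃.MinOutside⇒upper v-min)))
                  (s∉I₂ ∘ above s⋖v ∘ C₂.upper⇒MinOutside , t∉I₁ ∘ above t⋖v ∘ C₁.upper⇒MinOutside)
      where
        above : ∀ {y I} → y ⋖ v → MinOutside I v → y ∈ I
        above y⋖v (_ , v-min) = v-min _ (⋖⇒<ₚ y⋖v)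
        v-min : MinOutside I₃ v
        v-min = (λ { (here refl) → proj₂ (⋖⇒<ₚ s⋖v) refl
                   ; (there (here refl)) → proj₂ (⋖⇒<ₚ t⋖v) refl
                   ; (there (there v∈I₀)) → proj₂ (proj₁ (∈I₀⁻ v∈I₀)) refl }) ,
                λ q q<v → below q<v
          where
            below : ∀ {q} → q < v ₚ → q ∈ I₃
            below {q} q<v with ≟-below v (proj₁ q<v) (proj₁ (⋖⇒<ₚ s⋖v))
                             | ≟-below v (proj₁ q<v) (proj₁ (⋖⇒<ₚ t⋖v))
            ... | yes refl | _        = here refl
            ... | no _     | yes refl = there (here refl)
            ... | no q≢s   | no q≢t   = there (there (∈I₀⁺ q<v q≢s q≢t))

    impossible : ⊥
    impossible = <-irrefl (trans (sym lower-defect≡0) defects-agree) upper-defect-positive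

  diamond-interval : ∀ {u s t v} → u ⋖ s → u ⋖ t → s ⋖ v → t ⋖ v → s ≢ t →
                     ∀ {z} → u < z ₚ → z < v ₚ → z ≡ s ⊎ z ≡ t
  diamond-interval u⋖s u⋖t s⋖v t⋖v s≢t {z} u<z (z≤v , z≢v)
    with ≟-below _ z≤v (proj₁ (⋖⇒<ₚ s⋖v)) | ≟-below _ z≤v (proj₁ (⋖⇒<ₚ t⋖v))
  ... | yes z≡s | _       = inj₁ z≡s
  ... | no _    | yes z≡t = inj₂ z≡t
  ... | no z≢s  | no z≢t  =
    ⊥-elim (ThirdElementOfDiamond.impossible u⋖s u⋖t s⋖v t⋖v s≢t u<z (z≤v , z≢v) z≢s z≢t)

  IntervalsOfLengthTwo : P → Set
  IntervalsOfLengthTwo b = ∀ {a p z} → a ⋖ p → p ⋖ b → a < z ₚ → z < b ₚ → z ≢ p → a ⋖ z × z ⋖ b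

  intervalsOfLengthTwo-step : ∀ b → (∀ {c} → c < b ₚ → IntervalsOfLengthTwo c) → IntervalsOfLengthTwo b
  intervalsOfLengthTwo-step b below {a} {p} {z} a⋖p p⋖b a<z z<b z≢p =
    let c , z≤c , c⋖b = cover-above z<b in through c⋖b z≤c (p≢ z≤c)
    where
      p≢ : ∀ {c} → z ≤ c → p ≢ c
      p≢ z≤p refl = ⋖-empty a⋖p a<z (z≤p , z≢p)
      a≤b : a ≤ b
      a≤b = proj₁ (<ₚ-trans (⋖⇒<ₚ a⋖p) (⋖⇒<ₚ p⋖b))
      through : ∀ {c} → c ⋖ b → z ≤ c → p ≢ c → a ⋖ z × z ⋖ b
      through {c} c⋖b z≤c p≢c
        with (u , (u⋖p , u⋖c) , u-unique) , _ ← ucm p c p≢c (inj₂ (b , p⋖b , c⋖b))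
        with ≟-below b (proj₁ (<ₚ-trans (⋖⇒<ₚ u⋖p) (⋖⇒<ₚ p⋖b))) a≤b
      ... | yes refl = case diamond-interval u⋖p u⋖c p⋖b c⋖b p≢c a<z z<b of λ
        { (inj₁ z≡p)  → ⊥-elim (z≢p z≡p)
        ; (inj₂ refl) → u⋖c , c⋖b }
      -- otherwise a ⋖ c by induction at c, and a would be a second common lower cover of p and c
      ... | no u≢a
        with (g , (g⋖a , g⋖u) , _) , _ ← ucm a u (u≢a ∘ sym) (inj₂ (p , a⋖p , u⋖p))
        with _ , a⋖c ← below (⋖⇒<ₚ c⋖b) g⋖u u⋖c (⋖⇒<ₚ g⋖a) (<ₚ-≤-trans a<z z≤c) (u≢a ∘ sym)
        = ⊥-elim (u≢a (u-unique (a⋖p , a⋖c)))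

  intervalsOfLengthTwo : ∀ b → IntervalsOfLengthTwo b
  intervalsOfLengthTwo = WF.All.wfRec <ₚ-wellFounded _ IntervalsOfLengthTwo intervalsOfLengthTwo-step

lemma5p25 : (F : DistFominPoset) → let open DistFominPoset F in
    ∀ (p x y : P) → S p x → S p y →
    ∀ (b : P) → C⁺ p b → x < b ₚ → y < b ₚ →
    ∀ (a : P) → C⁻ p a → a < x ₚ → a < y ₚ →
    x ≡ y
lemma5p25 F p x y (x≢p , _) (y≢p , _) b p⋖b x<b y<b a a⋖p a<x a<y =
  let a⋖x , x⋖b = intervalsOfLengthTwo F b a⋖p p⋖b a<x x<b x≢p
  in case diamond-interval F a⋖p a⋖x p⋖b x⋖b (x≢p ∘ sym) a<y y<b of λ
       { (inj₁ y≡p) → ⊥-elim (y≢p y≡p)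
       ; (inj₂ y≡x) → sym y≡x }
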